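{- Let $\Gamma$ be a finite cc0-language. If $\Gamma$ has an endomorphism $h$ with $h(x)=y$, then the type of $x$ is not larger than the type of $y$.
   Context: $D$ is finite with distinguished $0$; $\Gamma$ is a finite set of relations on $D$ and $\mathrm{dom}(\Gamma)$ the set of values in its tuples. A relation is 0-valid if it contains the all-zero tuple; $\Gamma$ is a cc0-language if all its relations are 0-valid and every 0-valid relation obtained from a relation of $\Gamma$ by substituting constants for some coordinates (fixing and deleting them) belongs to $\Gamma$. An endomorphism is $h:\mathrm{dom}(\Gamma)\to\mathrm{dom}(\Gamma)$ with $h(0)=0$ mapping (coordinatewise) every tuple of every $R\in\Gamma$ into $R$. A multivalued morphism is $\phi:\mathrm{dom}(\Gamma)\to2^{\mathrm{dom}(\Gamma)}$ with $\phi(0)=\{0\}$ and $\phi(a_1)\times\dots\times\phi(a_r)\subseteq R$ for every $(a_1,..,a_r)\in R\in\Gamma$. $x$ produces $y$ if some multivalued morphism has $\phi(x)=\{0,y\}$ and $\phi(z)=\{0\}$ for all $z\ne x$. A value $y\in\mathrm{dom}(\Gamma)$ has type 1 (regular) if there is no multivalued morphism $\phi$ with $0,y\in\phi(x)$ for some $x$; type 2 (semiregular) if there is such a $\phi$ but no $x$ produces $y$; type 3 (self-producing) if $y$ produces $y$ and $y$ produces every $x$ that produces $y$; type 4 (degenerate) otherwise. -}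

module Defs where

open import Data.Nat using (ℕ; zero; suc; _≤_)
open import Data.Fin using (Fin)
open import Data.Bool using (Bool; true; false)
open import Data.Maybe using (Maybe; just; nothing)
open import Data.Vec using (Vec; []; _∷_; replicate)
open import Data.Vec.Membership.Propositional as VecMem using ()
open import Data.List using (List)
open import Data.List.Membership.Propositional as ListMem using ()
open import Data.Product using (Σ; ∃; _×_; _,_)
open import Data.Sum using (_⊎_)
open import Relation.Binary.PropositionalEquality using (_≡_; _≢_; refl)
open import Relation.Nullary using (¬_)
open import Function.Bundles using (_⇔_)

Dom : ℕ → Set
Dom n = Fin (suc n)

𝟘 : ∀ {n} → Dom n
𝟘 = Fin.zero

Rel : ℕ → ℕ → Set
Rel n r = Vec (Dom n) r → Bool

ARel : ℕ → Set
ARel n = Σ ℕ (Rel n)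

Lang : ℕ → Set
Lang n = List (ARel n)

SameRel : ∀ {n} → ARel n → ARel n → Set
SameRel {n} (r , R) (r' , R') = Σ (r ≡ r') (λ eq → go eq)
  where
  go : r ≡ r' → Set
  go refl = ∀ t → R t ≡ R' t

_∈Γ_ : ∀ {n} → ARel n → Lang n → Set
ρ ∈Γ Γ = Σ (ARel _) (λ ρ' → ρ' ListMem.∈ Γ × SameRel ρ ρ')

ZeroValid : ∀ {n} → ARel n → Set
ZeroValid (r , R) = R (replicate r 𝟘) ≡ true

-- Substituting constants: σ i = just c fixes coordinate i to c (and deletes it),
-- σ i = nothing keeps coordinate i.
holes : ∀ {n r} → Vec (Maybe (Dom n)) r → ℕ
holes [] = zero
holes (just _ ∷ σ) = holes σ
holes (nothing ∷ σ) = suc (holes σ)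

fill : ∀ {n r} (σ : Vec (Maybe (Dom n)) r) → Vec (Dom n) (holes σ) → Vec (Dom n) r
fill [] t = []
fill (just c ∷ σ) t = c ∷ fill σ t
fill (nothing ∷ σ) (x ∷ t) = x ∷ fill σ t

substConst : ∀ {n} (ρ : ARel n) → Vec (Maybe (Dom n)) (Data.Product.proj₁ ρ) → ARel n
substConst (r , R) σ = holes σ , (λ t → R (fill σ t))

IsCC0 : ∀ {n} → Lang n → Set
IsCC0 Γ = (∀ ρ → ρ ListMem.∈ Γ → ZeroValid ρ)
        × (∀ ρ → ρ ListMem.∈ Γ → (σ : Vec (Maybe _) (Data.Product.proj₁ ρ))
             → ZeroValid (substConst ρ σ) → substConst ρ σ ∈Γ Γ)

InRel : ∀ {n} → ARel n → Set
InRel {n} (r , R) = Σ (Vec (Dom n) r) (λ t → R t ≡ true)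

InDom : ∀ {n} → Lang n → Dom n → Set
InDom {n} Γ x = Σ (ARel n) λ ρ → ρ ListMem.∈ Γ ×
                  Σ (Vec (Dom n) (Data.Product.proj₁ ρ)) λ t →
                    Data.Product.proj₂ ρ t ≡ true × x VecMem.∈ t

-- Endomorphism (a map D → D whose restriction to dom(Γ) is the endomorphism;
-- values outside dom(Γ) are irrelevant).
IsEndo : ∀ {n} → Lang n → (Dom n → Dom n) → Set
IsEndo {n} Γ h = (∀ x → InDom Γ x → InDom Γ (h x))
               × h 𝟘 ≡ 𝟘
               × (∀ ρ → ρ ListMem.∈ Γ → ∀ t →
                    Data.Product.proj₂ ρ t ≡ true →
                    Data.Product.proj₂ ρ (Data.Vec.map h t) ≡ true)

-- Multivalued morphism; φ x y ≡ true means y ∈ φ(x).  Only the values of φ on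
-- dom(Γ) matter.
_∈φ_ : ∀ {n} → Dom n → Dom n → (Dom n → Dom n → Bool) → Set
(y ∈φ x) φ = φ x y ≡ true

PointwiseIn : ∀ {n r} → (Dom n → Dom n → Bool) → Vec (Dom n) r → Vec (Dom n) r → Set
PointwiseIn φ [] [] = Data.Unit.⊤ where import Data.Unit
PointwiseIn φ (a ∷ as) (b ∷ bs) = φ a b ≡ true × PointwiseIn φ as bs

IsMultiMorph : ∀ {n} → Lang n → (Dom n → Dom n → Bool) → Set
IsMultiMorph {n} Γ φ =
    (∀ x → InDom Γ x → ∀ y → φ x y ≡ true → InDom Γ y)
  × (∀ y → (φ 𝟘 y ≡ true ⇔ y ≡ 𝟘))
  × (∀ ρ → ρ ListMem.∈ Γ → ∀ a →
       Data.Product.proj₂ ρ a ≡ true → ∀ b → PointwiseIn φ a b →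
       Data.Product.proj₂ ρ b ≡ true)

Produces : ∀ {n} → Lang n → Dom n → Dom n → Set
Produces {n} Γ x y = Σ (Dom n → Dom n → Bool) λ φ → IsMultiMorph Γ φ
  × (∀ z → (φ x z ≡ true ⇔ (z ≡ 𝟘 ⊎ z ≡ y)))
  × (∀ z → InDom Γ z → z ≢ x → ∀ w → (φ z w ≡ true ⇔ w ≡ 𝟘))

Irregular : ∀ {n} → Lang n → Dom n → Set
Irregular {n} Γ y = Σ (Dom n → Dom n → Bool) λ φ → IsMultiMorph Γ φ
  × Σ (Dom n) λ x → InDom Γ x × φ x 𝟘 ≡ true × φ x y ≡ true

Type1 Type2 Type3 : ∀ {n} → Lang n → Dom n → Set
Type1 Γ y = ¬ Irregular Γ y
Type2 {n} Γ y = Irregular Γ y × ¬ (Σ (Dom n) λ x → InDom Γ x × Produces Γ x y)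
Type3 {n} Γ y = Produces Γ y y × (∀ x → InDom Γ x → Produces Γ x y → Produces Γ y x)

data ValueType : Set where
  regular semiregular selfProducing degenerate : ValueType

rank : ValueType → ℕ
rank regular = 1
rank semiregular = 2
rank selfProducing = 3
rank degenerate = 4

HasType : ∀ {n} → Lang n → Dom n → ValueType → Set
HasType Γ y regular = Type1 Γ y
HasType Γ y semiregular = ¬ Type1 Γ y × Type2 Γ y
HasType Γ y selfProducing = ¬ Type1 Γ y × ¬ Type2 Γ y × Type3 Γ y
HasType Γ y degenerate = ¬ Type1 Γ y × ¬ Type2 Γ y × ¬ Type3 Γ y

-- Let h be an endomorphism of a 0-valid language Γ and x ∈ dom(Γ).  We show
-- that every "lower bound" on the type of x transfers to h(x):
--   (a) if x is irregular (0, x ∈ φ(w) for some multivalued morphism φ) then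
--       so is h(x): compose φ with the graph of h;
--   (b) if z produces x then z produces h(x): compose the production with h;
--   (c) if h(x) produces u then x produces u: precompose the production with h;
--   (d) production is transitive.
-- All four constructions are instances of one principle: a Boolean
-- multivalued map ψ that factors, on dom(Γ), through two compatible maps φ
-- and χ is itself compatible with Γ.  For productions it is applied to the
-- elementary map "a ↦ {0, c}, everything else ↦ {0}".
-- From (a)–(d) it follows that if x is at least of type s then so is h(x),
-- and a value which is at least of type s and has type t satisfies
-- rank s ≤ rank t; the proposition combines the two.
module Submission where

open import Defs
open import Data.Nat using (ℕ; _≤_; z≤n; s≤s)
open import Data.Nat.Properties using (≤-refl)
open import Data.Fin using (_≟_)
open import Data.Fin.Properties using (any?)
open import Data.Bool using (Bool; true; _∨_; _∧_)
import Data.Bool as Bool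
open import Data.Bool.Properties using (∨-zeroʳ)
open import Data.Vec using (Vec; []; _∷_; replicate; map)
open import Data.Vec.Relation.Unary.Any using (here; there)
import Data.Vec.Membership.Propositional as VecMem
open import Data.List.Membership.Propositional using (_∈_)
open import Data.Product using (Σ; _×_; _,_; proj₁; proj₂)
open import Data.Sum using (_⊎_; inj₁; inj₂)
open import Data.Empty using (⊥-elim)
open import Data.Unit using (⊤; tt)
open import Relation.Binary.PropositionalEquality
  using (_≡_; _≢_; refl; sym; trans; subst; cong; cong₂)
open import Relation.Nullary using (¬_; Dec; does; yes; no)
open import Relation.Nullary.Decidable using (dec-true; _×-dec_)
open import Function using (_∘_)
open import Function.Bundles using (mk⇔; Equivalence)

open Equivalence using (to; from)

does-true : ∀ {P : Set} (P? : Dec P) → does P? ≡ true → P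
does-true (yes p) _ = p
does-true (no _) ()

module _ {n : ℕ} (Γ : Lang n) (zero-valid : ∀ ρ → ρ ∈ Γ → ZeroValid ρ) where

  private
    D : Set
    D = Dom n

  MultiMap : Set
  MultiMap = D → D → Bool

  Compatible : MultiMap → Set
  Compatible φ = ∀ ρ → ρ ∈ Γ → ∀ a → proj₂ ρ a ≡ true →
                 ∀ b → PointwiseIn φ a b → proj₂ ρ b ≡ true

  FactorsThrough : MultiMap → MultiMap → MultiMap → Set
  FactorsThrough ψ φ χ = ∀ w → InDom Γ w → ∀ v → ψ w v ≡ true →
                         Σ D λ m → φ w m ≡ true × χ m v ≡ true

  factor-tuple : ∀ {ψ φ χ : MultiMap} {r} (a b : Vec D r) →
                 (∀ w → w VecMem.∈ a → ∀ v → ψ w v ≡ true →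
                    Σ D λ m → φ w m ≡ true × χ m v ≡ true) →
                 PointwiseIn ψ a b →
                 Σ (Vec D r) λ m → PointwiseIn φ a m × PointwiseIn χ m b
  factor-tuple [] [] _ _ = [] , tt , tt
  factor-tuple (w ∷ a) (v ∷ b) split (wv , ab)
    with split w (here refl) v wv
       | factor-tuple a b (λ w' w'∈a → split w' (there w'∈a)) ab
  ... | m , wm , mv | ms , ams , msb = m ∷ ms , (wm , ams) , (mv , msb)

  compatible-factor : ∀ {ψ φ χ} → Compatible φ → Compatible χ →
                      FactorsThrough ψ φ χ → Compatible ψ
  compatible-factor φ-comp χ-comp split ρ ρ∈Γ a a∈ρ b ab
    with factor-tuple a b (λ w w∈a → split w (ρ , ρ∈Γ , a , a∈ρ , w∈a)) ab
  ... | m , am , mb = χ-comp ρ ρ∈Γ m (φ-comp ρ ρ∈Γ a a∈ρ m am) b mb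

  zero∈dom : ∀ {w} → InDom Γ w → InDom Γ 𝟘
  zero∈dom ((r , R) , ρ∈Γ , (_ ∷ _) , _ , _) =
    (r , R) , ρ∈Γ , replicate r 𝟘 , zero-valid (r , R) ρ∈Γ , here refl

  single : D → D → MultiMap
  single a c w v = does (v ≟ 𝟘) ∨ (does (w ≟ a) ∧ does (v ≟ c))

  -- Every edge of the elementary map goes to 0 or is a ↦ c (in the remaining
  -- cases the map is false, so the hypothesis is absurd).
  single-edge : ∀ a c w v → single a c w v ≡ true → v ≡ 𝟘 ⊎ (w ≡ a × v ≡ c)
  single-edge a c w v e with v ≟ 𝟘 | w ≟ a | v ≟ c
  ... | yes v≡0 | _       | _       = inj₁ v≡0
  ... | no _    | yes w≡a | yes v≡c = inj₂ (w≡a , v≡c)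

  single-hit : ∀ a c → single a c a c ≡ true
  single-hit a c rewrite dec-true (a ≟ a) refl | dec-true (c ≟ c) refl = ∨-zeroʳ _

  module Production {a b : D} (P : Produces Γ a b) where
    φ : MultiMap
    φ = proj₁ P

    hit : φ a b ≡ true
    hit = from (proj₁ (proj₂ (proj₂ P)) b) (inj₂ refl)

    to-zero : ∀ w → InDom Γ w → φ w 𝟘 ≡ true
    to-zero w w∈dom with w ≟ a
    ... | yes refl = from (proj₁ (proj₂ (proj₂ P)) 𝟘) (inj₁ refl)
    ... | no w≢a   = from (proj₂ (proj₂ (proj₂ P)) w w∈dom w≢a 𝟘) refl

    closed : ∀ w → InDom Γ w → ∀ v → φ w v ≡ true → InDom Γ v
    closed = proj₁ (proj₁ (proj₂ P))

    compatible : Compatible φ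
    compatible = proj₂ (proj₂ (proj₁ (proj₂ P)))

    target∈dom : InDom Γ a → InDom Γ b
    target∈dom a∈dom = closed a a∈dom b hit

    -- Since φ(0) = {0}, only 0 is produced by 0.
    zero-source : a ≡ 𝟘 → b ≡ 𝟘
    zero-source refl = to (proj₁ (proj₂ (proj₁ (proj₂ P))) b) hit

  produces-by-factoring : (a c : D) → InDom Γ c → (a ≡ 𝟘 → c ≡ 𝟘) →
                          (φ χ : MultiMap) → Compatible φ → Compatible χ →
                          FactorsThrough (single a c) φ χ → Produces Γ a c
  produces-by-factoring a c c∈dom zero-source φ χ φ-comp χ-comp split =
      single a c
    , ( (λ w w∈dom v e → closed w w∈dom v (single-edge a c w v e))
      , (λ v → mk⇔ (λ e → from-zero v (single-edge a c 𝟘 v e)) (λ { refl → refl }))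
      , compatible-factor {single a c} {φ} {χ} φ-comp χ-comp split )
    , (λ v → mk⇔ (λ e → from-a v (single-edge a c a v e))
                 (λ { (inj₁ refl) → refl ; (inj₂ refl) → single-hit a c }))
    , (λ w _ w≢a v → mk⇔ (λ e → from-other w≢a (single-edge a c w v e))
                         (λ { refl → refl }))
    where
    closed : ∀ w → InDom Γ w → ∀ v → v ≡ 𝟘 ⊎ (w ≡ a × v ≡ c) → InDom Γ v
    closed w w∈dom v (inj₁ refl)       = zero∈dom w∈dom
    closed w w∈dom v (inj₂ (_ , refl)) = c∈dom
    from-zero : ∀ v → v ≡ 𝟘 ⊎ (𝟘 ≡ a × v ≡ c) → v ≡ 𝟘
    from-zero v (inj₁ v≡0)          = v≡0
    from-zero v (inj₂ (0≡a , refl)) = zero-source (sym 0≡a)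
    from-a : ∀ v → v ≡ 𝟘 ⊎ (a ≡ a × v ≡ c) → v ≡ 𝟘 ⊎ v ≡ c
    from-a v (inj₁ v≡0)       = inj₁ v≡0
    from-a v (inj₂ (_ , v≡c)) = inj₂ v≡c
    from-other : ∀ {w v} → w ≢ a → v ≡ 𝟘 ⊎ (w ≡ a × v ≡ c) → v ≡ 𝟘
    from-other w≢a (inj₁ v≡0)       = v≡0
    from-other w≢a (inj₂ (w≡a , _)) = ⊥-elim (w≢a w≡a)

  produces-trans : ∀ {a b c} → InDom Γ a → Produces Γ a b → Produces Γ b c →
                   Produces Γ a c
  produces-trans {a} {b} {c} a∈dom P Q =
    produces-by-factoring a c (Q.target∈dom b∈dom) (Q.zero-source ∘ P.zero-source)
      P.φ Q.φ P.compatible Q.compatible split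
    where
    module P = Production P
    module Q = Production Q
    b∈dom = P.target∈dom a∈dom
    split : FactorsThrough (single a c) P.φ Q.φ
    split w w∈dom v e with single-edge a c w v e
    ... | inj₁ refl          = 𝟘 , P.to-zero w w∈dom , Q.to-zero 𝟘 (zero∈dom w∈dom)
    ... | inj₂ (refl , refl) = b , P.hit , Q.hit

  module _ (h : D → D) (endo : IsEndo Γ h) where

    private
      h-dom : ∀ x → InDom Γ x → InDom Γ (h x)
      h-dom = proj₁ endo

      h-zero : h 𝟘 ≡ 𝟘
      h-zero = proj₁ (proj₂ endo)

    graph : MultiMap
    graph m v = does (h m ≟ v)

    graph-hit : ∀ m → graph m (h m) ≡ true
    graph-hit m = dec-true (h m ≟ h m) refl

    graph-tuple : ∀ {r} (a b : Vec D r) → PointwiseIn graph a b → map h a ≡ b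
    graph-tuple [] [] _ = refl
    graph-tuple (x ∷ a) (y ∷ b) (xy , ab) =
      cong₂ _∷_ (does-true (h x ≟ y) xy) (graph-tuple a b ab)

    -- Compatibility of the graph is exactly the endomorphism property.
    graph-compatible : Compatible graph
    graph-compatible ρ ρ∈Γ a a∈ρ b ab =
      subst (λ t → proj₂ ρ t ≡ true) (graph-tuple a b ab) (proj₂ (proj₂ endo) ρ ρ∈Γ a a∈ρ)

    produces-image : ∀ {z x} → InDom Γ z → Produces Γ z x → Produces Γ z (h x)
    produces-image {z} {x} z∈dom P =
      produces-by-factoring z (h x) (h-dom x (target∈dom z∈dom)) zero-source′
        φ graph compatible graph-compatible split
      where
      open Production P
      zero-source′ : z ≡ 𝟘 → h x ≡ 𝟘
      zero-source′ z≡0 = trans (cong h (zero-source z≡0)) h-zero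
      split : FactorsThrough (single z (h x)) φ graph
      split w w∈dom v e with single-edge z (h x) w v e
      ... | inj₁ refl          = 𝟘 , to-zero w w∈dom , dec-true (h 𝟘 ≟ 𝟘) h-zero
      ... | inj₂ (refl , refl) = x , hit , graph-hit x

    produces-preimage : ∀ {x u} → InDom Γ x → Produces Γ (h x) u → Produces Γ x u
    produces-preimage {x} {u} x∈dom P =
      produces-by-factoring x u (target∈dom (h-dom x x∈dom)) zero-source′
        graph φ graph-compatible compatible split
      where
      open Production P
      zero-source′ : x ≡ 𝟘 → u ≡ 𝟘
      zero-source′ refl = zero-source h-zero
      split : FactorsThrough (single x u) graph φ
      split w w∈dom v e with single-edge x u w v e
      ... | inj₁ refl          = h w , graph-hit w , to-zero (h w) (h-dom w w∈dom)
      ... | inj₂ (refl , refl) = h x , graph-hit x , hit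

    -- The composite of φ with the graph of h: w ↦ h(φ(w)).
    image-edge? : (φ : MultiMap) → ∀ w u → Dec (Σ D λ v → φ w v ≡ true × h v ≡ u)
    image-edge? φ w u = any? (λ v → (φ w v Bool.≟ true) ×-dec (h v ≟ u))

    image : MultiMap → MultiMap
    image φ w u = does (image-edge? φ w u)

    irregular-image : ∀ {y} → Irregular Γ y → Irregular Γ (h y)
    irregular-image {y} (φ , (closed , zero-only , compatible) , x , x∈dom , x0 , xy) =
        image φ
      , ( (λ w w∈dom u e → let (v , wv , hv≡u) = does-true (image-edge? φ w u) e
                           in subst (InDom Γ) hv≡u (h-dom v (closed w w∈dom v wv)))
        , (λ u → mk⇔ (λ e → let (v , 0v , hv≡u) = does-true (image-edge? φ 𝟘 u) e
                            in trans (sym hv≡u) (trans (cong h (to (zero-only v) 0v)) h-zero))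
                     (λ { refl → dec-true (image-edge? φ 𝟘 𝟘) (𝟘 , from (zero-only 𝟘) refl , h-zero) }))
        , compatible-factor {image φ} {φ} {graph} compatible graph-compatible split )
      , x , x∈dom
      , dec-true (image-edge? φ x 𝟘) (𝟘 , x0 , h-zero)
      , dec-true (image-edge? φ x (h y)) (y , xy , refl)
      where
      split : FactorsThrough (image φ) φ graph
      split w _ u e = let (v , wv , hv≡u) = does-true (image-edge? φ w u) e
                      in v , wv , dec-true (h v ≟ u) hv≡u

    -- If h(x) is self-producing and x is produced by some value, then x is
    -- self-producing: everything producing x produces h(x), hence is
    -- produced by h(x), hence by x.
    type3-preimage : ∀ {x} → InDom Γ x → Σ D (λ z → InDom Γ z × Produces Γ z x) →
                     Type3 Γ (h x) → Type3 Γ x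
    type3-preimage {x} x∈dom (z , z∈dom , z⇝x) (_ , hx⇝producers) =
        produces-preimage x∈dom
          (produces-trans (h-dom x x∈dom) (back z z∈dom z⇝x) z⇝x)
      , λ w w∈dom w⇝x → produces-preimage x∈dom (back w w∈dom w⇝x)
      where
      back : ∀ w → InDom Γ w → Produces Γ w x → Produces Γ (h x) w
      back w w∈dom w⇝x = hx⇝producers w w∈dom (produces-image w∈dom w⇝x)

AtLeast : ∀ {n} → Lang n → Dom n → ValueType → Set
AtLeast Γ y regular       = ⊤
AtLeast Γ y semiregular   = ¬ Type1 Γ y
AtLeast Γ y selfProducing = ¬ Type1 Γ y × ¬ Type2 Γ y
AtLeast Γ y degenerate    = ¬ Type1 Γ y × ¬ Type2 Γ y × ¬ Type3 Γ y

has-type⇒at-least : ∀ {n} {Γ : Lang n} {y} t → HasType Γ y t → AtLeast Γ y t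
has-type⇒at-least regular       _               = tt
has-type⇒at-least semiregular   (¬t1 , _)       = ¬t1
has-type⇒at-least selfProducing (¬t1 , ¬t2 , _) = ¬t1 , ¬t2
has-type⇒at-least degenerate    at-least        = at-least

at-least⇒rank≤ : ∀ {n} {Γ : Lang n} {y} s t → AtLeast Γ y s → HasType Γ y t →
                 rank s ≤ rank t
at-least⇒rank≤ regular       regular       _               _           = ≤-refl
at-least⇒rank≤ regular       semiregular   _               _           = s≤s z≤n
at-least⇒rank≤ regular       selfProducing _               _           = s≤s z≤n
at-least⇒rank≤ regular       degenerate    _               _           = s≤s z≤n
at-least⇒rank≤ semiregular   regular       ¬t1             t1          = ⊥-elim (¬t1 t1)
at-least⇒rank≤ semiregular   semiregular   _               _           = ≤-refl
at-least⇒rank≤ semiregular   selfProducing _               _           = s≤s (s≤s z≤n)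
at-least⇒rank≤ semiregular   degenerate    _               _           = s≤s (s≤s z≤n)
at-least⇒rank≤ selfProducing regular       (¬t1 , _)       t1          = ⊥-elim (¬t1 t1)
at-least⇒rank≤ selfProducing semiregular   (_ , ¬t2)       (_ , t2)    = ⊥-elim (¬t2 t2)
at-least⇒rank≤ selfProducing selfProducing _               _           = ≤-refl
at-least⇒rank≤ selfProducing degenerate    _               _           = s≤s (s≤s (s≤s z≤n))
at-least⇒rank≤ degenerate    regular       (¬t1 , _)       t1          = ⊥-elim (¬t1 t1)
at-least⇒rank≤ degenerate    semiregular   (_ , ¬t2 , _)   (_ , t2)    = ⊥-elim (¬t2 t2)
at-least⇒rank≤ degenerate    selfProducing (_ , _ , ¬t3)   (_ , _ , t3) = ⊥-elim (¬t3 t3)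
at-least⇒rank≤ degenerate    degenerate    _               _           = ≤-refl

not-unproduced : ∀ {n} {Γ : Lang n} {x} → ¬ Type1 Γ x → ¬ Type2 Γ x →
                 ¬ ¬ Σ (Dom n) (λ z → InDom Γ z × Produces Γ z x)
not-unproduced ¬t1 ¬t2 unproduced = ¬t1 (λ irregular → ¬t2 (irregular , unproduced))

at-least-image : ∀ {n} (Γ : Lang n) → (∀ ρ → ρ ∈ Γ → ZeroValid ρ) → (h : Dom n → Dom n) → IsEndo Γ h →
                 ∀ {x} → InDom Γ x → ∀ s → AtLeast Γ x s → AtLeast Γ (h x) s
at-least-image Γ zv h endo x∈dom regular tt = tt
at-least-image Γ zv h endo x∈dom semiregular ¬t1 =
  λ t1 → ¬t1 (λ irregular → t1 (irregular-image Γ zv h endo irregular))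
at-least-image Γ zv h endo x∈dom selfProducing (¬t1 , ¬t2) =
    at-least-image Γ zv h endo x∈dom semiregular ¬t1
  , λ { (_ , hx-unproduced) → not-unproduced ¬t1 ¬t2 λ { (z , z∈dom , z⇝x) →
        hx-unproduced (z , z∈dom , produces-image Γ zv h endo z∈dom z⇝x) } }
at-least-image Γ zv h endo x∈dom degenerate (¬t1 , ¬t2 , ¬t3)
  with at-least-image Γ zv h endo x∈dom selfProducing (¬t1 , ¬t2)
... | ¬hx-t1 , ¬hx-t2 =
    ¬hx-t1 , ¬hx-t2
  , λ t3 → not-unproduced ¬t1 ¬t2 λ produced →
      ¬t3 (type3-preimage Γ zv h endo x∈dom produced t3)

proposition3p9 : ∀ {n} (Γ : Lang n) → IsCC0 Γ
    → (h : Dom n → Dom n) → IsEndo Γ h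
    → (x y : Dom n) → InDom Γ x → h x ≡ y
    → (s t : ValueType) → HasType Γ x s → HasType Γ y t
    → rank s ≤ rank t
proposition3p9 Γ cc h endo x .(h x) x∈dom refl s t x-has-s hx-has-t =
  at-least⇒rank≤ s t
    (at-least-image Γ (proj₁ cc) h endo x∈dom s (has-type⇒at-least s x-has-s))
    hx-has-t
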